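{- For any graph $G$ and any $u\in V(G)$, there exists a proper $\Delta(G)$-orientation $D$ of $G$ such that $d^-_D(u)=0$.
   Context: An orientation $D$ of a graph $G$ replaces each edge by exactly one of its two possible arcs; $d^-_D(v)$ is the indegree of $v$. $D$ is proper if adjacent vertices have distinct indegrees; a $k$-orientation has maximum indegree at most $k$. $\Delta(G)$ is the maximum degree. -}

module Defs where

open import Data.Nat using (ℕ; zero; suc; _+_; _≤_; _⊔_)
open import Data.Fin using (Fin; zero; suc)
open import Data.Bool using (Bool; true; false; if_then_else_)
open import Data.Product using (_×_; Σ)
open import Data.Sum using (_⊎_)
open import Relation.Binary.PropositionalEquality using (_≡_)
open import Relation.Nullary using (¬_)

record Graph (n : ℕ) : Set where
  field
    adj     : Fin n → Fin n → Bool
    symm    : ∀ i j → adj i j ≡ adj j i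
    irrefl  : ∀ i → adj i i ≡ false

open Graph public

count : ∀ {n} → (Fin n → Bool) → ℕ
count {zero}  p = 0
count {suc n} p = (if p zero then 1 else 0) + count (λ i → p (suc i))

maxOver : ∀ {n} → (Fin n → ℕ) → ℕ
maxOver {zero}  f = 0
maxOver {suc n} f = f zero ⊔ maxOver (λ i → f (suc i))

degree : ∀ {n} → Graph n → Fin n → ℕ
degree G v = count (adj G v)

maxDegree : ∀ {n} → Graph n → ℕ
maxDegree G = maxOver (degree G)

-- An orientation of G: arc i j ≡ true means the edge ij is oriented i → j.
-- Every edge gets exactly one of its two arcs; non-edges get no arc.
record Orientation {n : ℕ} (G : Graph n) : Set where
  field
    arc     : Fin n → Fin n → Bool
    onEdge  : ∀ i j → adj G i j ≡ true →
              (arc i j ≡ true × arc j i ≡ false) ⊎ (arc i j ≡ false × arc j i ≡ true)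
    offEdge : ∀ i j → adj G i j ≡ false → arc i j ≡ false

open Orientation public

indegree : ∀ {n} {G : Graph n} → Orientation G → Fin n → ℕ
indegree D v = count (λ j → arc D j v)

Proper : ∀ {n} {G : Graph n} → Orientation G → Set
Proper {G = G} D = ∀ i j → adj G i j ≡ true → ¬ (indegree D i ≡ indegree D j)

IsKOrientation : ∀ {n} {G : Graph n} → ℕ → Orientation G → Set
IsKOrientation k D = ∀ v → indegree D v ≤ k

-- Orient G along a linear order that puts u first, so that u is a source. As long as some arc
-- x → y joins vertices of equal indegree d, reverse it: the indegrees become d + 1 and d − 1, so
-- the sum of squared indegrees grows by 2, and it is bounded by n³, so the process ends in a
-- proper orientation. The reversed arc never touches u: no arc enters u, and an arc leaving u
-- would have a head of positive indegree, unlike u. Any orientation has indegrees at most Δ(G).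
module Submission where

open import Defs
open import Data.Nat using (ℕ; zero; suc; _+_; _*_; _≤_; _<_; _<?_; z≤n; s≤s)
open import Data.Nat.Properties hiding (_≟_)
open import Data.Nat.Tactic.RingSolver using (solve-∀)
open import Data.Fin using (Fin; zero; suc; toℕ; _≟_)
open import Data.Fin.Properties using (toℕ-injective; any?) renaming (suc-injective to Fin-suc-injective)
open import Data.Bool using (Bool; true; false; if_then_else_; _∧_)
open import Data.Bool.Properties using (∧-zeroʳ)
open import Data.Product as Product using (Σ; ∃₂; _×_; _,_)
open import Data.Sum as Sum using (_⊎_; inj₁; inj₂)
open import Function using (_∘_)
open import Function.Definitions using (Injective)
open import Relation.Nullary using (¬_; Dec; yes; no; does; contradiction)
open import Relation.Nullary.Decidable using (dec-true; dec-false; _×-dec_; _⊎-dec_)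
open import Relation.Binary.Definitions using (tri<; tri≈; tri>)
open import Relation.Binary.PropositionalEquality

count-cong : ∀ {n} {p q : Fin n → Bool} → (∀ i → p i ≡ q i) → count p ≡ count q
count-cong {zero}  h = refl
count-cong {suc n} h = cong₂ _+_ (cong (λ b → if b then 1 else 0) (h zero)) (count-cong (λ i → h (suc i)))

count-false : ∀ {n} {p : Fin n → Bool} → (∀ i → p i ≡ false) → count p ≡ 0
count-false {zero}  h = refl
count-false {suc n} h rewrite h zero = count-false (λ i → h (suc i))

count-≤ : ∀ {n} (p : Fin n → Bool) → count p ≤ n
count-≤ {zero}  p = z≤n
count-≤ {suc n} p with p zero
... | true  = s≤s (count-≤ (λ i → p (suc i)))
... | false = m≤n⇒m≤1+n (count-≤ (λ i → p (suc i)))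

count-mono : ∀ {n} {p q : Fin n → Bool} → (∀ i → p i ≡ true → q i ≡ true) → count p ≤ count q
count-mono {zero}          h = z≤n
count-mono {suc n} {p} {q} h with p zero in pz | q zero in qz
... | true  | true  = s≤s (count-mono (λ i → h (suc i)))
... | true  | false = contradiction (trans (sym (h zero pz)) qz) λ ()
... | false | true  = m≤n⇒m≤1+n (count-mono (λ i → h (suc i)))
... | false | false = count-mono (λ i → h (suc i))

count-add : ∀ {n} {p q : Fin n → Bool} (a : Fin n) → p a ≡ false → q a ≡ true →
            (∀ i → i ≢ a → p i ≡ q i) → count q ≡ suc (count p)
count-add {suc n} zero pa qa h rewrite pa | qa =
  cong suc (count-cong (λ i → sym (h (suc i) λ ())))
count-add {suc n} {p} {q} (suc a) pa qa h rewrite h zero (λ ()) =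
  trans (cong (head +_) (count-add a pa qa (λ i i≢a → h (suc i) (i≢a ∘ Fin-suc-injective))))
        (+-suc head _)
  where head = if q zero then 1 else 0

maxOver-≥ : ∀ {n} (f : Fin n → ℕ) (v : Fin n) → f v ≤ maxOver f
maxOver-≥ f zero    = m≤m⊔n _ _
maxOver-≥ f (suc v) = ≤-trans (maxOver-≥ (λ i → f (suc i)) v) (m≤n⊔m _ _)

sum : ∀ {n} → (Fin n → ℕ) → ℕ
sum {zero}  f = 0
sum {suc n} f = f zero + sum (λ i → f (suc i))

sum-cong : ∀ {n} {f g : Fin n → ℕ} → (∀ i → f i ≡ g i) → sum f ≡ sum g
sum-cong {zero}  h = refl
sum-cong {suc n} h = cong₂ _+_ (h zero) (sum-cong (λ i → h (suc i)))

sum-≤ : ∀ {n} {f : Fin n → ℕ} (b : ℕ) → (∀ i → f i ≤ b) → sum f ≤ n * b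
sum-≤ {zero}  b h = z≤n
sum-≤ {suc n} b h = +-mono-≤ (h zero) (sum-≤ b (λ i → h (suc i)))

-- Both sides are moved so that no subtraction occurs.
sum-agree-except₁ : ∀ {n} {f g : Fin n → ℕ} (a : Fin n) → (∀ i → i ≢ a → f i ≡ g i) →
                    sum f + g a ≡ sum g + f a
sum-agree-except₁ {suc n} {f} {g} zero h =
  begin
    f zero + sum (λ i → f (suc i)) + g zero
      ≡⟨ cong (λ s → f zero + s + g zero) (sum-cong (λ i → h (suc i) λ ())) ⟩
    f zero + rest + g zero                  ≡⟨ rotate (f zero) rest (g zero) ⟩
    g zero + rest + f zero                  ∎
  where
  open ≡-Reasoning
  rest : ℕ
  rest = sum (λ i → g (suc i))
  rotate : ∀ a b c → a + b + c ≡ c + b + a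
  rotate = solve-∀
sum-agree-except₁ {suc n} {f} {g} (suc a) h rewrite h zero (λ ()) =
  begin
    g zero + sum (λ i → f (suc i)) + g (suc a)   ≡⟨ +-assoc (g zero) _ _ ⟩
    g zero + (sum (λ i → f (suc i)) + g (suc a))
      ≡⟨ cong (g zero +_) (sum-agree-except₁ a (λ i i≢a → h (suc i) (i≢a ∘ Fin-suc-injective))) ⟩
    g zero + (sum (λ i → g (suc i)) + f (suc a)) ≡⟨ +-assoc (g zero) _ _ ⟨
    g zero + sum (λ i → g (suc i)) + f (suc a)   ∎
  where open ≡-Reasoning

sum-agree-except₂ : ∀ {n} {f g : Fin n → ℕ} {x y : Fin n} → x ≢ y →
                    (∀ i → i ≢ x → i ≢ y → f i ≡ g i) →
                    sum f + g x + g y ≡ sum g + f x + f y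
sum-agree-except₂ {f = f} {g} {x} {y} x≢y h =
  begin
    sum f + g x + g y ≡⟨ cong (λ t → sum f + t + g y) mx ⟨
    sum f + m x + g y ≡⟨ cong (_+ g y) (sum-agree-except₁ x f≗m) ⟩
    sum m + f x + g y ≡⟨ swapʳ (sum m) (f x) (g y) ⟩
    sum m + g y + f x ≡⟨ cong (_+ f x) (sum-agree-except₁ y m≗g) ⟩
    sum g + m y + f x ≡⟨ cong (λ t → sum g + t + f x) my ⟩
    sum g + f y + f x ≡⟨ swapʳ (sum g) (f y) (f x) ⟩
    sum g + f x + f y ∎
  where
  open ≡-Reasoning
  swapʳ : ∀ a b c → a + b + c ≡ a + c + b
  swapʳ = solve-∀
  m : Fin _ → ℕ
  m i = if does (i ≟ x) then g i else f i
  mx : m x ≡ g x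
  mx = cong (if_then g x else f x) (dec-true (x ≟ x) refl)
  my : m y ≡ f y
  my = cong (if_then g y else f y) (dec-false (y ≟ x) (x≢y ∘ sym))
  f≗m : ∀ i → i ≢ x → f i ≡ m i
  f≗m i i≢x = sym (cong (if_then g i else f i) (dec-false (i ≟ x) i≢x))
  m≗g : ∀ i → i ≢ y → m i ≡ g i
  m≗g i i≢y with i ≟ x
  ... | yes refl = refl
  ... | no i≢x   = h i i≢x i≢y

ExactlyOne : Bool → Bool → Set
ExactlyOne a b = (a ≡ true × b ≡ false) ⊎ (a ≡ false × b ≡ true)

exactlyOne-swap : ∀ {a b} → ExactlyOne a b → ExactlyOne b a
exactlyOne-swap = Sum.swap ∘ Sum.map Product.swap Product.swap

<?-exactlyOne : ∀ {a b} → a ≢ b → ExactlyOne (does (a <? b)) (does (b <? a))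
<?-exactlyOne {a} {b} a≢b with <-cmp a b
... | tri< a<b _ b≮a = inj₁ (dec-true (a <? b) a<b , dec-false (b <? a) b≮a)
... | tri≈ _ a≡b _   = contradiction a≡b a≢b
... | tri> a≮b _ b<a = inj₂ (dec-false (a <? b) a≮b , dec-true (b <? a) b<a)

module _ {n : ℕ} {G : Graph n} where

  arc⇒adj : (D : Orientation G) {i j : Fin n} → arc D i j ≡ true → adj G i j ≡ true
  arc⇒adj D {i} {j} ij with adj G i j in e
  ... | true  = refl
  ... | false = contradiction (trans (sym ij) (offEdge D i j e)) λ ()

  adj⇒≢ : {i j : Fin n} → adj G i j ≡ true → i ≢ j
  adj⇒≢ {i} ij refl = contradiction (trans (sym ij) (irrefl G i)) λ ()

  arc⇒≢ : (D : Orientation G) {i j : Fin n} → arc D i j ≡ true → i ≢ j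
  arc⇒≢ D = adj⇒≢ ∘ arc⇒adj D

  arc⇒¬arc : (D : Orientation G) {i j : Fin n} → arc D i j ≡ true → arc D j i ≡ false
  arc⇒¬arc D {i} {j} ij with onEdge D i j (arc⇒adj D ij)
  ... | inj₁ (_ , ji≡false) = ji≡false
  ... | inj₂ (ij≡false , _) = contradiction (trans (sym ij) ij≡false) λ ()

  indegree≤maxDegree : (D : Orientation G) → IsKOrientation (maxDegree G) D
  indegree≤maxDegree D v =
    ≤-trans (count-mono (λ j ji → trans (symm G v j) (arc⇒adj D ji))) (maxOver-≥ (degree G) v)

  Source : Fin n → Orientation G → Set
  Source u D = ∀ j → arc D j u ≡ false

  source⇒indegree≡0 : ∀ {u} (D : Orientation G) → Source u D → indegree D u ≡ 0
  source⇒indegree≡0 D = count-false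

  rankOrientation : (r : Fin n → ℕ) → Injective _≡_ _≡_ r → Orientation G
  rankOrientation r r-injective = record
    { arc     = λ i j → adj G i j ∧ does (r i <? r j)
    ; onEdge  = onEdge′
    ; offEdge = λ i j ij → cong (_∧ does (r i <? r j)) ij
    }
    where
    onEdge′ : ∀ i j → adj G i j ≡ true →
              ExactlyOne (adj G i j ∧ does (r i <? r j)) (adj G j i ∧ does (r j <? r i))
    onEdge′ i j ij rewrite ij | trans (symm G j i) ij = <?-exactlyOne (adj⇒≢ ij ∘ r-injective)

  rankOrientation-source : ∀ {u} (r : Fin n → ℕ) (r-injective : Injective _≡_ _≡_ r) → r u ≡ 0 →
                           Source u (rankOrientation r r-injective)
  rankOrientation-source {u} r _ ru≡0 j =
    trans (cong (adj G j u ∧_) (dec-false (r j <? r u) (λ rj<ru → n≮0 (subst (r j <_) ru≡0 rj<ru))))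
          (∧-zeroʳ (adj G j u))

  SameEnds : Fin n → Fin n → Fin n → Fin n → Set
  SameEnds x y i j = (i ≡ x × j ≡ y) ⊎ (i ≡ y × j ≡ x)

  sameEnds? : ∀ x y i j → Dec (SameEnds x y i j)
  sameEnds? x y i j = (i ≟ x ×-dec j ≟ y) ⊎-dec (i ≟ y ×-dec j ≟ x)

  sameEnds-swap : ∀ {x y i j} → SameEnds x y i j → SameEnds x y j i
  sameEnds-swap (inj₁ (i≡x , j≡y)) = inj₂ (j≡y , i≡x)
  sameEnds-swap (inj₂ (i≡y , j≡x)) = inj₁ (j≡x , i≡y)

  reversedArc : Orientation G → Fin n → Fin n → Fin n → Fin n → Bool
  reversedArc D x y i j = if does (sameEnds? x y i j) then arc D j i else arc D i j

  reversedArc-same : ∀ {D x y i j} → SameEnds x y i j → reversedArc D x y i j ≡ arc D j i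
  reversedArc-same {D} {x} {y} {i} {j} s =
    cong (if_then arc D j i else arc D i j) (dec-true (sameEnds? x y i j) s)

  reversedArc-other : ∀ {D x y i j} → ¬ SameEnds x y i j → reversedArc D x y i j ≡ arc D i j
  reversedArc-other {D} {x} {y} {i} {j} ¬s =
    cong (if_then arc D j i else arc D i j) (dec-false (sameEnds? x y i j) ¬s)

  reverse : Orientation G → Fin n → Fin n → Orientation G
  reverse D x y = record
    { arc     = reversedArc D x y
    ; onEdge  = onEdge′
    ; offEdge = offEdge′
    }
    where
    onEdge′ : ∀ i j → adj G i j ≡ true → ExactlyOne (reversedArc D x y i j) (reversedArc D x y j i)
    onEdge′ i j ij with sameEnds? x y i j
    ... | yes s  = subst₂ ExactlyOne (sym (reversedArc-same {D} s))
                                     (sym (reversedArc-same {D} (sameEnds-swap s)))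
                                     (exactlyOne-swap (onEdge D i j ij))
    ... | no ¬s  = subst₂ ExactlyOne (sym (reversedArc-other {D} ¬s))
                                     (sym (reversedArc-other {D} (¬s ∘ sameEnds-swap)))
                                     (onEdge D i j ij)

    offEdge′ : ∀ i j → adj G i j ≡ false → reversedArc D x y i j ≡ false
    offEdge′ i j ij with sameEnds? x y i j
    ... | yes s  = trans (reversedArc-same {D} s) (offEdge D j i (trans (symm G j i) ij))
    ... | no ¬s  = trans (reversedArc-other {D} ¬s) (offEdge D i j ij)

  reverse-source : ∀ {u x y} (D : Orientation G) → u ≢ x → u ≢ y → Source u D → Source u (reverse D x y)
  reverse-source {u} {x} {y} D u≢x u≢y src j = trans (reversedArc-other {D} ends) (src j)
    where
    ends : ¬ SameEnds x y j u
    ends (inj₁ (_ , u≡y)) = u≢y u≡y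
    ends (inj₂ (_ , u≡x)) = u≢x u≡x

  squareSum : Orientation G → ℕ
  squareSum D = sum λ v → indegree D v * indegree D v

  squareSum≤ : (D : Orientation G) → squareSum D ≤ n * (n * n)
  squareSum≤ D = sum-≤ (n * n) λ v → *-mono-≤ (indegree≤n v) (indegree≤n v)
    where
    indegree≤n : ∀ v → indegree D v ≤ n
    indegree≤n v = count-≤ (λ j → arc D j v)

  module _ (D : Orientation G) {x y : Fin n} (xy : arc D x y ≡ true) where

    private
      x≢y : x ≢ y
      x≢y = arc⇒≢ D xy

    indegree-reverse-head : indegree D y ≡ suc (indegree (reverse D x y) y)
    indegree-reverse-head =
      count-add x (trans (reversedArc-same {D} (inj₁ (refl , refl))) (arc⇒¬arc D xy)) xy
                (λ j j≢x → reversedArc-other {D} λ where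
                  (inj₁ (j≡x , _)) → j≢x j≡x
                  (inj₂ (_ , y≡x)) → x≢y (sym y≡x))

    indegree-reverse-tail : indegree (reverse D x y) x ≡ suc (indegree D x)
    indegree-reverse-tail =
      count-add y (arc⇒¬arc D xy) (trans (reversedArc-same {D} (inj₂ (refl , refl))) xy)
                (λ j j≢y → sym (reversedArc-other {D} λ where
                  (inj₁ (_ , x≡y)) → x≢y x≡y
                  (inj₂ (j≡y , _)) → j≢y j≡y))

    indegree-reverse-other : ∀ v → v ≢ x → v ≢ y → indegree (reverse D x y) v ≡ indegree D v
    indegree-reverse-other v v≢x v≢y = count-cong λ j → reversedArc-other {D} {x} {y} {j} λ where
      (inj₁ (_ , v≡y)) → v≢y v≡y
      (inj₂ (_ , v≡x)) → v≢x v≡x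

    -- Indegrees (d+1, d+1) at (x, y) become (d+2, d), which raises the sum of squares by 2.
    squareSum-reverse : indegree D x ≡ indegree D y → squareSum (reverse D x y) ≡ 2 + squareSum D
    squareSum-reverse dx≡dy = +-cancelʳ-≡ (sq (suc d) + sq (suc d)) _ _ (begin
      squareSum D′ + (sq (suc d) + sq (suc d))      ≡⟨ +-assoc (squareSum D′) _ _ ⟨
      squareSum D′ + sq (suc d) + sq (suc d)        ≡⟨ cong₂ (λ a b → squareSum D′ + sq a + sq b) dx dy ⟨
      squareSum D′ + sq (indegree D x) + sq (indegree D y)
        ≡⟨ sum-agree-except₂ x≢y (λ v v≢x v≢y → cong sq (indegree-reverse-other v v≢x v≢y)) ⟩
      squareSum D + sq (indegree D′ x) + sq (indegree D′ y)
        ≡⟨ cong (λ a → squareSum D + sq a + sq d) (trans indegree-reverse-tail (cong suc dx)) ⟩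
      squareSum D + sq (suc (suc d)) + sq d         ≡⟨ squares (squareSum D) d ⟩
      2 + squareSum D + (sq (suc d) + sq (suc d))   ∎)
      where
      open ≡-Reasoning
      D′ : Orientation G
      D′ = reverse D x y
      sq : ℕ → ℕ
      sq k = k * k
      d : ℕ
      d = indegree D′ y
      dy : indegree D y ≡ suc d
      dy = indegree-reverse-head
      dx : indegree D x ≡ suc d
      dx = trans dx≡dy dy
      squares : ∀ s d → s + (2 + d) * (2 + d) + d * d ≡ 2 + s + ((1 + d) * (1 + d) + (1 + d) * (1 + d))
      squares = solve-∀

  Conflict : Orientation G → Set
  Conflict D = ∃₂ λ x y → arc D x y ≡ true × indegree D x ≡ indegree D y

  conflict? : (D : Orientation G) → Dec (Conflict D)
  conflict? D = any? λ x → any? λ y →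
    (arc D x y Data.Bool.≟ true) ×-dec (indegree D x Data.Nat.≟ indegree D y)

  ¬conflict⇒proper : (D : Orientation G) → ¬ Conflict D → Proper D
  ¬conflict⇒proper D ¬c i j ij with onEdge D i j ij
  ... | inj₁ (i→j , _) = λ di≡dj → ¬c (i , j , i→j , di≡dj)
  ... | inj₂ (_ , j→i) = λ di≡dj → ¬c (j , i , j→i , sym di≡dj)

  -- Each reversal raises squareSum ≤ n³, so the fuel never runs out.
  properSourceOrientation : ∀ {u} (fuel : ℕ) (D : Orientation G) → Source u D →
                            n * (n * n) < squareSum D + fuel → Σ (Orientation G) λ D → Proper D × Source u D
  properSourceOrientation zero D src gap =
    contradiction (squareSum≤ D) (<⇒≱ (subst (n * (n * n) <_) (+-identityʳ (squareSum D)) gap))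
  properSourceOrientation {u} (suc fuel) D src gap with conflict? D
  ... | no ¬c = D , ¬conflict⇒proper D ¬c , src
  ... | yes (x , y , xy , dx≡dy) =
    properSourceOrientation fuel (reverse D x y) (reverse-source D u≢x u≢y src) gap′
    where
    u≢y : u ≢ y
    u≢y refl = contradiction (trans (sym xy) (src x)) λ ()
    u≢x : u ≢ x
    u≢x refl = contradiction (trans (sym (source⇒indegree≡0 D src)) (trans dx≡dy (indegree-reverse-head D xy)))
                             λ ()
    gap′ : n * (n * n) < squareSum (reverse D x y) + fuel
    gap′ = <-≤-trans (subst (n * (n * n) <_) (+-suc (squareSum D) fuel) gap)
                     (+-monoˡ-≤ fuel (≤-trans (n≤1+n _) (≤-reflexive (sym (squareSum-reverse D xy dx≡dy)))))

rank : ∀ {n} → Fin n → Fin n → ℕ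
rank u i = if does (i ≟ u) then 0 else suc (toℕ i)

rank-injective : ∀ {n} (u : Fin n) → Injective _≡_ _≡_ (rank u)
rank-injective u {i} {j} ri≡rj with i ≟ u | j ≟ u
... | yes refl | yes refl = refl
... | no _     | no _     = toℕ-injective (suc-injective ri≡rj)

rank-self : ∀ {n} (u : Fin n) → rank u u ≡ 0
rank-self u = cong (if_then 0 else suc (toℕ u)) (dec-true (u ≟ u) refl)

corollary18 : ∀ (n : ℕ) (G : Graph n) (u : Fin n) →
    Σ (Orientation G) (λ D → Proper D × IsKOrientation (maxDegree G) D × indegree D u ≡ 0)
corollary18 n G u =
  let D , proper , source = properSourceOrientation (suc (n * (n * n))) D₀ source₀ (m≤n+m _ (squareSum D₀))
  in  D , proper , indegree≤maxDegree D , source⇒indegree≡0 D source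
  where
  D₀ : Orientation G
  D₀ = rankOrientation (rank u) (rank-injective u)
  source₀ : Source u D₀
  source₀ = rankOrientation-source {G = G} (rank u) (rank-injective u) (rank-self u)
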